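{- For every deducibility constraint system $C$, there is no infinite reduction sequence $C\leadsto_{\theta_1}C_1\leadsto_{\theta_2}C_2\leadsto_{\theta_3}\cdots$.
   Context: Messages are built from names and variables using only pairing $\langle M,N\rangle$ and symmetric encryption $\{M\}_N$; equality is syntactic; $V(\cdot)$ is the set of variables occurring. Sequent rules ($\Gamma,M$ means $\Gamma\cup\{M\}$): (id) $\Gamma\vdash M$ if $M\in\Gamma$; ($p_L$) from $\Gamma,\langle M,N\rangle,M,N\vdash T$ infer $\Gamma,\langle M,N\rangle\vdash T$; ($p_R$) from $\Gamma\vdash M,\Gamma\vdash N$ infer $\Gamma\vdash\langle M,N\rangle$; ($e_L$) from $\Gamma,\{M\}_K\vdash K$ and $\Gamma,\{M\}_K,M,K\vdash N$ infer $\Gamma,\{M\}_K\vdash N$; ($e_R$) from $\Gamma\vdash M,\Gamma\vdash K$ infer $\Gamma\vdash\{M\}_K$. $\Gamma\Vdash M$: derivable; $\Gamma\Vdash_RM$: derivable using only id, $p_R$, $e_R$; $\Gamma\Vdash\Delta$: $\Gamma\Vdash N$ for all $N\in\Delta$. A deducibility constraint is $\Sigma\Vdash^?M$ (proper) or $\Sigma\Vdash^?_RM$ (right). Substitutions are applied postfix. A ground substitution $\theta$ is a solution of a list $C$ of constraints if $\Sigma\theta\Vdash M\theta$ for each proper and $\Sigma\theta\Vdash_RM\theta$ for each right constraint in $C$. $C^i$: prefix of length $i-1$. A deducibility constraint system is a list $\Sigma_1\Vdash^?_{(R)}M_1;\cdots;\Sigma_n\Vdash^?_{(R)}M_n$ with: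 (1) for $i<j$, letting $\Sigma_j^{dv}$ be $\Sigma_j$ minus messages containing a variable occurring in no message of $\Sigma_i$, every solution $\theta$ of $C^j$ satisfies $\Sigma_j^{dv}\theta\Vdash\Sigma_i\theta$; (2) every $x\in V(C)$ has an index $i$ with $x\in V(M_i)$, $x\notin V(\Sigma_i)$, and $x$ not occurring in any constraint of index $j<i$. Reductions ($\leadsto$ means $\leadsto_\epsilon$, $\epsilon$ identity; $C_1,C_2$ arbitrary lists): C1: $C_1;\Sigma\Vdash^?_RM;C_2\leadsto_\theta C_1\theta;C_2\theta$ if $M$ is not a variable and $\theta=mgu(M,N)$ for some $N\in\Sigma$; C2: $C_1;\Sigma\Vdash^?_Rf(M,N);C_2\leadsto C_1;\Sigma\Vdash^?_RM;\Sigma\Vdash^?_RN;C_2$ ($f$ pairing or encryption); C3: $C_1;\Sigma\Vdash^?M;C_2\leadsto C_1;\Sigma\Vdash^?_RM;C_2$; C4: $C_1;(\Sigma,\langle M,N\rangle\Vdash^?U);C_2\leadsto C_1;(\Sigma,M,N\Vdash^?U);C_2$ if $\langle M,N\rangle\notin\Sigma$; C5: $C_1;(\Sigma,\{M\}_N\Vdash^?U);C_2\leadsto C_1;(\Sigma,\{M\}_N\Vdash^?_RN);(\Sigma,M,N\Vdash^?U);C_2$ if $\{M\}_N\notin\Sigma$. -}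

module Defs where

open import Data.Nat as ℕ using (ℕ; _<_)
open import Data.Fin using (Fin; toℕ)
open import Data.List using (List; []; _∷_; _++_; map; filter; concatMap; take; length; lookup)
open import Data.List.Membership.Propositional using (_∈_; _∉_)
open import Data.List.Membership.DecPropositional ℕ._≟_ using (_∈?_)
open import Data.List.Relation.Unary.All using (All; all?)
open import Data.Product using (Σ; ∃; _×_; _,_)
open import Relation.Nullary using (¬_; Dec; yes; no; ¬?)
open import Relation.Binary.PropositionalEquality using (_≡_; refl; cong; cong₂)

data Msg : Set where
  name : ℕ → Msg
  var  : ℕ → Msg
  pair : Msg → Msg → Msg
  enc  : Msg → Msg → Msg   -- { M }_N   (enc M N)

private
  name-inj : ∀ {a b} → name a ≡ name b → a ≡ b
  name-inj refl = refl
  var-inj : ∀ {a b} → var a ≡ var b → a ≡ b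
  var-inj refl = refl
  pair-inj₁ : ∀ {a b c d} → pair a b ≡ pair c d → a ≡ c
  pair-inj₁ refl = refl
  pair-inj₂ : ∀ {a b c d} → pair a b ≡ pair c d → b ≡ d
  pair-inj₂ refl = refl
  enc-inj₁ : ∀ {a b c d} → enc a b ≡ enc c d → a ≡ c
  enc-inj₁ refl = refl
  enc-inj₂ : ∀ {a b c d} → enc a b ≡ enc c d → b ≡ d
  enc-inj₂ refl = refl

_≟M_ : (M N : Msg) → Dec (M ≡ N)
name a ≟M name b with a ℕ.≟ b
... | yes refl = yes refl
... | no ne = no λ e → ne (name-inj e)
name _ ≟M var _ = no λ ()
name _ ≟M pair _ _ = no λ ()
name _ ≟M enc _ _ = no λ ()
var _ ≟M name _ = no λ ()
var a ≟M var b with a ℕ.≟ b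
... | yes refl = yes refl
... | no ne = no λ e → ne (var-inj e)
var _ ≟M pair _ _ = no λ ()
var _ ≟M enc _ _ = no λ ()
pair _ _ ≟M name _ = no λ ()
pair _ _ ≟M var _ = no λ ()
pair a b ≟M pair c d with a ≟M c | b ≟M d
... | yes refl | yes refl = yes refl
... | no ne | _ = no λ e → ne (pair-inj₁ e)
... | yes _ | no ne = no λ e → ne (pair-inj₂ e)
pair _ _ ≟M enc _ _ = no λ ()
enc _ _ ≟M name _ = no λ ()
enc _ _ ≟M var _ = no λ ()
enc _ _ ≟M pair _ _ = no λ ()
enc a b ≟M enc c d with a ≟M c | b ≟M d
... | yes refl | yes refl = yes refl
... | no ne | _ = no λ e → ne (enc-inj₁ e)
... | yes _ | no ne = no λ e → ne (enc-inj₂ e)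

vars : Msg → List ℕ
vars (name _) = []
vars (var x) = x ∷ []
vars (pair M N) = vars M ++ vars N
vars (enc M N) = vars M ++ vars N

varsL : List Msg → List ℕ
varsL = concatMap vars

IsVar : Msg → Set
IsVar M = ∃ λ x → M ≡ var x

Ground : Msg → Set
Ground M = vars M ≡ []

Subst : Set
Subst = ℕ → Msg

ι : Subst
ι = var

infixl 20 _·_
_·_ : Msg → Subst → Msg
name a · θ = name a
var x · θ = θ x
pair M N · θ = pair (M · θ) (N · θ)
enc M N · θ = enc (M · θ) (N · θ)

infixl 20 _·L_
_·L_ : List Msg → Subst → List Msg
Γ ·L θ = map (_· θ) Γ

GroundSubst : Subst → Set
GroundSubst θ = ∀ x → Ground (θ x)

-- θ is a (idempotent) most general unifier of M and N:
-- θ unifies M and N, and every unifier σ of M and N satisfies θσ = σ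
-- (i.e. (x θ) σ ≡ x σ for every variable x).
IsMGU : Subst → Msg → Msg → Set
IsMGU θ M N = (M · θ ≡ N · θ)
            × (∀ σ → M · σ ≡ N · σ → ∀ x → θ x · σ ≡ σ x)

-- Sequent calculus.  A finite set Γ of messages is represented by a list;
-- all rules only use membership, "Γ , M" is M ∷ Γ.

infix 4 _⊩_ _⊩R_

data _⊩_ : List Msg → Msg → Set where
  id  : ∀ {Γ M} → M ∈ Γ → Γ ⊩ M
  pL  : ∀ {Γ M N T} → pair M N ∈ Γ → (M ∷ N ∷ Γ) ⊩ T → Γ ⊩ T
  pR  : ∀ {Γ M N} → Γ ⊩ M → Γ ⊩ N → Γ ⊩ pair M N
  eL  : ∀ {Γ M K N} → enc M K ∈ Γ → Γ ⊩ K → (M ∷ K ∷ Γ) ⊩ N → Γ ⊩ N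
  eR  : ∀ {Γ M K} → Γ ⊩ M → Γ ⊩ K → Γ ⊩ enc M K

data _⊩R_ (Γ : List Msg) : Msg → Set where
  id  : ∀ {M} → M ∈ Γ → Γ ⊩R M
  pR  : ∀ {M N} → Γ ⊩R M → Γ ⊩R N → Γ ⊩R pair M N
  eR  : ∀ {M K} → Γ ⊩R M → Γ ⊩R K → Γ ⊩R enc M K

infix 4 _⊩*_
_⊩*_ : List Msg → List Msg → Set
Γ ⊩* Δ = All (Γ ⊩_) Δ

data Kind : Set where
  proper right : Kind

record Constraint : Set where
  constructor ⟦_⊩?[_]_⟧
  field
    lhs  : List Msg
    kind : Kind
    rhs  : Msg
open Constraint public

substC : Subst → Constraint → Constraint
substC θ ⟦ Σ' ⊩?[ k ] M ⟧ = ⟦ Σ' ·L θ ⊩?[ k ] M · θ ⟧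

substCs : Subst → List Constraint → List Constraint
substCs θ = map (substC θ)

varsC : Constraint → List ℕ
varsC c = varsL (lhs c) ++ vars (rhs c)

varsCs : List Constraint → List ℕ
varsCs = concatMap varsC

SatC : Subst → Constraint → Set
SatC θ ⟦ Σ' ⊩?[ proper ] M ⟧ = Σ' ·L θ ⊩ M · θ
SatC θ ⟦ Σ' ⊩?[ right ] M ⟧ = Σ' ·L θ ⊩R M · θ

Solution : Subst → List Constraint → Set
Solution θ C = GroundSubst θ × All (SatC θ) C

dv : List Msg → List Msg → List Msg
dv Σi Σj = filter (λ m → all? (λ x → x ∈? varsL Σi) (vars m)) Σj

-- Deducibility constraint system (0-indexed positions; C^j = take j C)
record IsDCS (C : List Constraint) : Set where
  field
    monotone : ∀ (i j : Fin (length C)) → toℕ i < toℕ j →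
      ∀ θ → Solution θ (take (toℕ j) C) →
      dv (lhs (lookup C i)) (lhs (lookup C j)) ·L θ ⊩* (lhs (lookup C i) ·L θ)
    origin : ∀ x → x ∈ varsCs C →
      Σ (Fin (length C)) λ i →
        (x ∈ vars (rhs (lookup C i)))
        × (x ∉ varsL (lhs (lookup C i)))
        × (∀ (j : Fin (length C)) → toℕ j < toℕ i → x ∉ varsC (lookup C j))

remove : Msg → List Msg → List Msg
remove P = filter (λ X → ¬? (X ≟M P))

data Step : Subst → List Constraint → List Constraint → Set where
  C1 : ∀ {θ} C₁ C₂ Σ' M N → ¬ IsVar M → N ∈ Σ' → IsMGU θ M N →
       Step θ (C₁ ++ ⟦ Σ' ⊩?[ right ] M ⟧ ∷ C₂) (substCs θ C₁ ++ substCs θ C₂)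
  C2p : ∀ C₁ C₂ Σ' M N →
       Step ι (C₁ ++ ⟦ Σ' ⊩?[ right ] pair M N ⟧ ∷ C₂)
              (C₁ ++ ⟦ Σ' ⊩?[ right ] M ⟧ ∷ ⟦ Σ' ⊩?[ right ] N ⟧ ∷ C₂)
  C2e : ∀ C₁ C₂ Σ' M N →
       Step ι (C₁ ++ ⟦ Σ' ⊩?[ right ] enc M N ⟧ ∷ C₂)
              (C₁ ++ ⟦ Σ' ⊩?[ right ] M ⟧ ∷ ⟦ Σ' ⊩?[ right ] N ⟧ ∷ C₂)
  C3 : ∀ C₁ C₂ Σ' M →
       Step ι (C₁ ++ ⟦ Σ' ⊩?[ proper ] M ⟧ ∷ C₂) (C₁ ++ ⟦ Σ' ⊩?[ right ] M ⟧ ∷ C₂)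
  -- Γ = Σ , ⟨M,N⟩ with ⟨M,N⟩ ∉ Σ, i.e. Σ = Γ \ {⟨M,N⟩}
  C4 : ∀ C₁ C₂ Γ M N U → pair M N ∈ Γ →
       Step ι (C₁ ++ ⟦ Γ ⊩?[ proper ] U ⟧ ∷ C₂)
              (C₁ ++ ⟦ M ∷ N ∷ remove (pair M N) Γ ⊩?[ proper ] U ⟧ ∷ C₂)
  -- Γ = Σ , {M}_N with {M}_N ∉ Σ
  C5 : ∀ C₁ C₂ Γ M N U → enc M N ∈ Γ →
       Step ι (C₁ ++ ⟦ Γ ⊩?[ proper ] U ⟧ ∷ C₂)
              (C₁ ++ ⟦ Γ ⊩?[ right ] N ⟧ ∷ ⟦ M ∷ N ∷ remove (enc M N) Γ ⊩?[ proper ] U ⟧ ∷ C₂)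

InfiniteReduction : List Constraint → Set
InfiniteReduction C =
  Σ (ℕ → List Constraint) λ f → (f 0 ≡ C) × (∀ i → ∃ λ θ → Step θ (f i) (f (ℕ.suc i)))

module Submission where

-- Every reduction step A ↝θ B *shrinks* the system: B has no variable
-- that A lacks, and either some variable of A has disappeared from B or
-- the weight of B is strictly smaller.  The weight of a right constraint
-- Σ ⊩R U is the size of U, that of a proper constraint Σ ⊩ U is
-- 1 + |Σ|² + |U|; so C2 and C3 make a constraint lighter, and C4, C5
-- shrink |Σ|, which pays for everything they add.  For C1 the mgu θ is
-- either the identity, and the solved constraint is merely deleted, or
-- it moves a variable x of the unified messages; then, θ being
-- idempotent, x occurs in no image θ y, and every variable of an image
-- θ y is y itself or one of the unified messages.
--
-- Along a reduction sequence the pair (number of initial variables still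
-- present, weight) therefore decreases lexicographically, which is well
-- founded.

open import Defs
open import Data.Nat as ℕ using (ℕ; zero; suc; _+_; _*_; _≤_; _<_; z≤n; s≤s)
open import Data.Nat.Properties
open import Data.Nat.ListAction using (sum)
open import Data.Nat.ListAction.Properties using (sum-++)
open import Data.Nat.Induction using (<-wellFounded)
open import Data.List using (List; []; _∷_; _++_; map; filter; length; concatMap)
open import Data.List.Properties using (map-++; map-cong; map-id; concatMap-++)
open import Data.List.Membership.Propositional using (_∈_; _∉_; find)
open import Data.List.Membership.Propositional.Properties using (∈-++⁻; ∈-++⁺ʳ)
open import Data.List.Membership.DecPropositional ℕ._≟_ using (_∈?_)
open import Data.List.Relation.Unary.Any using (here; there)
open import Data.List.Relation.Unary.All as All using (All; []; _∷_; all?)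
open import Data.List.Relation.Unary.All.Properties using (¬All⇒Any¬)
open import Data.List.Relation.Binary.Subset.Propositional using (_⊆_)
open import Data.List.Relation.Binary.Subset.Propositional.Properties
  using (⊆-refl; ⊆-trans; xs⊆xs++ys; xs⊆ys++xs; xs⊆x∷xs; ++⁺ʳ; ++⁺ˡ; concatMap⁺; filter-⊆)
open import Data.Product using (∃; _×_; _,_; proj₁; proj₂)
open import Data.Product.Relation.Binary.Lex.Strict using (×-Lex; ×-wellFounded)
open import Data.Sum using (_⊎_; inj₁; inj₂)
open import Data.Empty using (⊥)
open import Induction.InfiniteDescent using (Descent; descent∧wf⇒empty)
open import Relation.Nullary using (¬_; ¬?; yes; no; contradiction)
open import Relation.Unary using (Decidable)
open import Function using (_∘_)
open import Relation.Binary.PropositionalEquality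

++-lub : {A : Set} {xs ys S : List A} → xs ⊆ S → ys ⊆ S → xs ++ ys ⊆ S
++-lub {xs = xs} xs⊆S ys⊆S m with ∈-++⁻ xs m
... | inj₁ m′ = xs⊆S m′
... | inj₂ m′ = ys⊆S m′

concatMap-∈ : {A B : Set} (f : A → List B) {a : A} {as : List A} →
              a ∈ as → f a ⊆ concatMap f as
concatMap-∈ f {as = b ∷ as} (here refl) = xs⊆xs++ys (f b) (concatMap f as)
concatMap-∈ f {as = b ∷ as} (there a∈as) = ⊆-trans (concatMap-∈ f a∈as) (xs⊆ys++xs _ (f b))

varsCs-++ : (A B : List Constraint) → varsCs (A ++ B) ≡ varsCs A ++ varsCs B
varsCs-++ = concatMap-++ varsC

varsCs-lub : {D : List Constraint} {S : List ℕ} → All (λ d → varsC d ⊆ S) D → varsCs D ⊆ S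
varsCs-lub [] ()
varsCs-lub (d⊆S ∷ D⊆S) = ++-lub d⊆S (varsCs-lub D⊆S)

pair-injective : ∀ {A B A′ B′} → pair A B ≡ pair A′ B′ → A ≡ A′ × B ≡ B′
pair-injective refl = refl , refl

enc-injective : ∀ {A B A′ B′} → enc A B ≡ enc A′ B′ → A ≡ A′ × B ≡ B′
enc-injective refl = refl , refl

·-cong : ∀ T {σ σ′ : Subst} → (∀ {y} → y ∈ vars T → σ y ≡ σ′ y) → T · σ ≡ T · σ′
·-cong (name a) agree = refl
·-cong (var x) agree = agree (here refl)
·-cong (pair A B) agree =
  cong₂ pair (·-cong A (agree ∘ xs⊆xs++ys _ _)) (·-cong B (agree ∘ xs⊆ys++xs _ (vars A)))
·-cong (enc A B) agree =
  cong₂ enc (·-cong A (agree ∘ xs⊆xs++ys _ _)) (·-cong B (agree ∘ xs⊆ys++xs _ (vars A)))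

·-identity : ∀ T → T · ι ≡ T
·-identity (name a) = refl
·-identity (var x) = refl
·-identity (pair A B) = cong₂ pair (·-identity A) (·-identity B)
·-identity (enc A B) = cong₂ enc (·-identity A) (·-identity B)

·-injective : ∀ T {σ σ′ : Subst} {y} → T · σ ≡ T · σ′ → y ∈ vars T → σ y ≡ σ′ y
·-injective (var x) e (here refl) = e
·-injective (pair A B) e m with ∈-++⁻ (vars A) m
... | inj₁ m′ = ·-injective A (proj₁ (pair-injective e)) m′
... | inj₂ m′ = ·-injective B (proj₂ (pair-injective e)) m′
·-injective (enc A B) e m with ∈-++⁻ (vars A) m
... | inj₁ m′ = ·-injective A (proj₁ (enc-injective e)) m′
... | inj₂ m′ = ·-injective B (proj₂ (enc-injective e)) m′

substCs-identity : ∀ {θ} → (∀ x → θ x ≡ var x) → ∀ C → substCs θ C ≡ C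
substCs-identity {θ} fixes C = trans (map-cong substC-identity C) (map-id C)
  where
  ·-fixed : ∀ T → T · θ ≡ T
  ·-fixed T = trans (·-cong T (λ {y} _ → fixes y)) (·-identity T)
  substC-identity : ∀ c → substC θ c ≡ c
  substC-identity ⟦ Γ ⊩?[ k ] U ⟧ =
    cong₂ (λ Γ′ U′ → ⟦ Γ′ ⊩?[ k ] U′ ⟧) (trans (map-cong ·-fixed Γ) (map-id Γ)) (·-fixed U)

Origin : Subst → List ℕ → ℕ → Set
Origin θ S x = ∃ λ y → y ∈ S × x ∈ vars (θ y)

origin-++ : ∀ θ {S S′ x} xs {ys} → (x ∈ xs → Origin θ S x) → (x ∈ ys → Origin θ S′ x) →
            x ∈ xs ++ ys → Origin θ (S ++ S′) x
origin-++ θ {S} {S′} xs fromˡ fromʳ m with ∈-++⁻ xs m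
... | inj₁ m′ = let y , y∈S , x∈θy = fromˡ m′ in y , xs⊆xs++ys S S′ y∈S , x∈θy
... | inj₂ m′ = let y , y∈S′ , x∈θy = fromʳ m′ in y , xs⊆ys++xs S′ S y∈S′ , x∈θy

vars-· : ∀ T θ {x} → x ∈ vars (T · θ) → Origin θ (vars T) x
vars-· (var y) θ m = y , here refl , m
vars-· (pair A B) θ = origin-++ θ (vars (A · θ)) (vars-· A θ) (vars-· B θ)
vars-· (enc A B) θ = origin-++ θ (vars (A · θ)) (vars-· A θ) (vars-· B θ)

vars-·L : ∀ Γ θ {x} → x ∈ varsL (Γ ·L θ) → Origin θ (varsL Γ) x
vars-·L (T ∷ Γ) θ = origin-++ θ (vars (T · θ)) (vars-· T θ) (vars-·L Γ θ)

vars-·C : ∀ c θ {x} → x ∈ varsC (substC θ c) → Origin θ (varsC c) x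
vars-·C ⟦ Γ ⊩?[ k ] U ⟧ θ = origin-++ θ (varsL (Γ ·L θ)) (vars-·L Γ θ) (vars-· U θ)

vars-·Cs : ∀ C θ {x} → x ∈ varsCs (substCs θ C) → Origin θ (varsCs C) x
vars-·Cs (c ∷ C) θ = origin-++ θ (varsC (substC θ c)) (vars-·C c θ) (vars-·Cs C θ)

_[_↦_] : Subst → ℕ → Msg → Subst
(σ [ z ↦ M ]) y with y ℕ.≟ z
... | yes _ = M
... | no _ = σ y

update-same : ∀ σ z M → (σ [ z ↦ M ]) z ≡ M
update-same σ z M with z ℕ.≟ z
... | yes _ = refl
... | no z≢z = contradiction refl z≢z

update-other : ∀ σ {z y} M → y ≢ z → (σ [ z ↦ M ]) y ≡ σ y
update-other σ {z} {y} M y≢z with y ℕ.≟ z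
... | yes y≡z = contradiction y≡z y≢z
... | no _ = refl

name0≢name1 : name 0 ≢ name 1
name0≢name1 ()

name-probe : ∀ T σ z → T · (σ [ z ↦ name 0 ]) ≡ name 0 → T · (σ [ z ↦ name 1 ]) ≡ name 1 → T ≡ var z
name-probe (name a) σ z refl ()
name-probe (var w) σ z e₀ e₁ with w ℕ.≟ z
... | yes w≡z = cong var w≡z
... | no _ = contradiction (trans (sym e₀) e₁) name0≢name1

module MostGeneralUnifier {θ : Subst} {M N : Msg} (mgu : IsMGU θ M N) where

  W : List ℕ
  W = vars M ++ vars N

  -- Changing θ at a variable z outside W gives another unifier, through
  -- which θ must factor.
  factors : ∀ {z} b → z ∉ W → ∀ y → θ y · (θ [ z ↦ name b ]) ≡ (θ [ z ↦ name b ]) y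
  factors {z} b z∉W = proj₂ mgu σ (begin
      M · σ  ≡⟨ ·-cong M (unchanged {M} (xs⊆xs++ys (vars M) (vars N))) ⟩
      M · θ  ≡⟨ proj₁ mgu ⟩
      N · θ  ≡⟨ ·-cong N (unchanged {N} (xs⊆ys++xs (vars N) (vars M))) ⟨
      N · σ  ∎)
    where
    open ≡-Reasoning
    σ : Subst
    σ = θ [ z ↦ name b ]
    unchanged : ∀ {T} → vars T ⊆ W → ∀ {y} → y ∈ vars T → σ y ≡ θ y
    unchanged T⊆W {y} y∈T = update-other θ (name b) (λ y≡z → z∉W (subst (_∈ W) y≡z (T⊆W y∈T)))

  fixes-outside : ∀ {z} → z ∉ W → θ z ≡ var z
  fixes-outside {z} z∉W = name-probe (θ z) θ z (probe 0) (probe 1)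
    where
    probe : ∀ b → θ z · (θ [ z ↦ name b ]) ≡ name b
    probe b = trans (factors b z∉W z) (update-same θ z (name b))

  image-vars : ∀ {y z} → z ∈ vars (θ y) → z ∈ W ⊎ z ≡ y
  image-vars {y} {z} z∈θy with z ∈? W | z ℕ.≟ y
  ... | yes z∈W | _ = inj₁ z∈W
  ... | no _ | yes z≡y = inj₂ z≡y
  ... | no z∉W | no z≢y = contradiction
      (trans (sym (update-same θ z (name 0)))
             (trans (·-injective (θ y) same-instance z∈θy) (update-same θ z (name 1))))
      name0≢name1
    where
    y≢z : y ≢ z
    y≢z y≡z = z≢y (sym y≡z)
    same-instance : θ y · (θ [ z ↦ name 0 ]) ≡ θ y · (θ [ z ↦ name 1 ])
    same-instance = trans (factors 0 z∉W y) (trans (update-other θ (name 0) y≢z)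
                      (sym (trans (factors 1 z∉W y) (update-other θ (name 1) y≢z))))

  -- θ is idempotent, so a variable it moves occurs in none of its images.
  moved-eliminated : ∀ {x} → θ x ≢ var x → ∀ y → x ∉ vars (θ y)
  moved-eliminated θx≢x y x∈θy =
    θx≢x (·-injective (θ y) (trans (proj₂ mgu θ (proj₁ mgu) y) (sym (·-identity (θ y)))) x∈θy)

  fixed? : Decidable (λ x → θ x ≡ var x)
  fixed? x = θ x ≟M var x

  identity-or-moves : (∀ x → θ x ≡ var x) ⊎ (∃ λ x → x ∈ W × θ x ≢ var x)
  identity-or-moves with all? fixed? W
  ... | yes fixed = inj₁ fixes
    where
    fixes : ∀ x → θ x ≡ var x
    fixes x with x ∈? W
    ... | yes x∈W = All.lookup fixed x∈W
    ... | no x∉W = fixes-outside x∉W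
  ... | no ¬fixed = inj₂ (find (¬All⇒Any¬ fixed? W ¬fixed))

size : Msg → ℕ
size (name _) = 1
size (var _) = 1
size (pair M N) = suc (size M + size N)
size (enc M N) = suc (size M + size N)

size-pos : ∀ M → 0 < size M
size-pos (name _) = s≤s z≤n
size-pos (var _) = s≤s z≤n
size-pos (pair _ _) = s≤s z≤n
size-pos (enc _ _) = s≤s z≤n

sizeL : List Msg → ℕ
sizeL Γ = sum (map size Γ)

wc : Constraint → ℕ
wc ⟦ Γ ⊩?[ proper ] U ⟧ = suc (sizeL Γ * sizeL Γ + size U)
wc ⟦ Γ ⊩?[ right ] U ⟧ = size U

weight : List Constraint → ℕ
weight C = sum (map wc C)

weight-++ : ∀ A B → weight (A ++ B) ≡ weight A + weight B
weight-++ A B = trans (cong sum (map-++ wc A B)) (sum-++ (map wc A) (map wc B))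

sizeL-remove≤ : ∀ P Γ → sizeL (remove P Γ) ≤ sizeL Γ
sizeL-remove≤ P [] = z≤n
sizeL-remove≤ P (Y ∷ Γ) with Y ≟M P
... | yes _ = ≤-trans (sizeL-remove≤ P Γ) (m≤n+m (sizeL Γ) (size Y))
... | no _ = +-monoʳ-≤ (size Y) (sizeL-remove≤ P Γ)

sizeL-remove : ∀ {P} Γ → P ∈ Γ → size P + sizeL (remove P Γ) ≤ sizeL Γ
sizeL-remove {P} (X ∷ Γ) P∈XΓ with X ≟M P | P∈XΓ
... | yes refl | _ = +-monoʳ-≤ (size X) (sizeL-remove≤ X Γ)
... | no X≢P | here P≡X = contradiction (sym P≡X) X≢P
... | no _ | there P∈Γ = begin
  size P + (size X + sizeL (remove P Γ))  ≡⟨ +-comm (size P) _ ⟩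
  (size X + sizeL (remove P Γ)) + size P  ≡⟨ +-assoc (size X) _ _ ⟩
  size X + (sizeL (remove P Γ) + size P)  ≡⟨ cong (size X +_) (+-comm _ (size P)) ⟩
  size X + (size P + sizeL (remove P Γ))  ≤⟨ +-monoʳ-≤ (size X) (sizeL-remove Γ P∈Γ) ⟩
  size X + sizeL Γ                        ∎
  where open ≤-Reasoning

square-absorbs : ∀ {a b s} → a < s → b < s → a + b * b < s * s
square-absorbs {s = suc t} (s≤s a≤t) (s≤s b≤t) =
  s≤s (+-mono-≤ a≤t (≤-trans (*-mono-≤ b≤t b≤t) (*-monoʳ-≤ t (n≤1+n t))))

proper-lighter : ∀ {a Γ Γ′} U → a < sizeL Γ → sizeL Γ′ < sizeL Γ →
                 a + wc ⟦ Γ′ ⊩?[ proper ] U ⟧ < wc ⟦ Γ ⊩?[ proper ] U ⟧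
proper-lighter {a} {Γ} {Γ′} U a< Γ′< = begin-strict
  a + suc (s′ * s′ + size U)  ≡⟨ +-suc a _ ⟩
  suc (a + (s′ * s′ + size U))  ≡⟨ cong suc (+-assoc a (s′ * s′) (size U)) ⟨
  suc (a + s′ * s′ + size U)  <⟨ s≤s (+-monoˡ-< (size U) (square-absorbs a< Γ′<)) ⟩
  suc (s * s + size U)        ∎
  where
  open ≤-Reasoning
  s = sizeL Γ
  s′ = sizeL Γ′

data Composite : Msg → Msg → Msg → Set where
  pairᶜ : ∀ {M N} → Composite (pair M N) M N
  encᶜ  : ∀ {M N} → Composite (enc M N) M N

composite-varsˡ : ∀ {P M N} → Composite P M N → vars M ⊆ vars P
composite-varsˡ {M = M} {N} pairᶜ = xs⊆xs++ys (vars M) (vars N)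
composite-varsˡ {M = M} {N} encᶜ = xs⊆xs++ys (vars M) (vars N)

composite-varsʳ : ∀ {P M N} → Composite P M N → vars N ⊆ vars P
composite-varsʳ {M = M} {N} pairᶜ = xs⊆ys++xs (vars N) (vars M)
composite-varsʳ {M = M} {N} encᶜ = xs⊆ys++xs (vars N) (vars M)

composite-size : ∀ {P M N} → Composite P M N → size M + size N < size P
composite-size pairᶜ = n<1+n _
composite-size encᶜ = n<1+n _

decompose-vars : ∀ {Γ P M N} → Composite P M N → P ∈ Γ → varsL (M ∷ N ∷ remove P Γ) ⊆ varsL Γ
decompose-vars {Γ} {P} c P∈Γ =
  ++-lub (⊆-trans (composite-varsˡ c) P⊆Γ)
    (++-lub (⊆-trans (composite-varsʳ c) P⊆Γ) (concatMap⁺ vars (filter-⊆ (λ X → ¬? (X ≟M P)) Γ)))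
  where
  P⊆Γ : vars P ⊆ varsL Γ
  P⊆Γ = concatMap-∈ vars P∈Γ

decompose-size : ∀ {Γ P M N} → Composite P M N → P ∈ Γ → sizeL (M ∷ N ∷ remove P Γ) < sizeL Γ
decompose-size {Γ} {P} {M} {N} c P∈Γ = begin-strict
  size M + (size N + r)  ≡⟨ +-assoc (size M) (size N) r ⟨
  size M + size N + r    <⟨ +-monoˡ-< r (composite-size c) ⟩
  size P + r             ≤⟨ sizeL-remove Γ P∈Γ ⟩
  sizeL Γ                ∎
  where
  open ≤-Reasoning
  r = sizeL (remove P Γ)

size-∈ : ∀ {Γ P} → P ∈ Γ → size P ≤ sizeL Γ
size-∈ {Γ} {P} P∈Γ = ≤-trans (m≤m+n (size P) _) (sizeL-remove Γ P∈Γ)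

record Shrinks (A B : List Constraint) : Set where
  constructor shrinks
  field
    vars-⊆   : varsCs B ⊆ varsCs A
    progress : (∃ λ x → x ∈ varsCs A × x ∉ varsCs B) ⊎ weight B < weight A

replace : ∀ C₁ C₂ {c D} → All (λ d → varsC d ⊆ varsC c) D → weight D < wc c →
          Shrinks (C₁ ++ c ∷ C₂) (C₁ ++ D ++ C₂)
replace C₁ C₂ {c} {D} D⊆c lighter = shrinks vars⊆ (inj₂ weight<)
  where
  vars⊆ : varsCs (C₁ ++ D ++ C₂) ⊆ varsCs (C₁ ++ c ∷ C₂)
  vars⊆ rewrite varsCs-++ C₁ (D ++ C₂) | varsCs-++ C₁ (c ∷ C₂) | varsCs-++ D C₂ =
    ++⁺ʳ (varsCs C₁) (++⁺ˡ (varsCs C₂) (varsCs-lub D⊆c))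
  weight< : weight (C₁ ++ D ++ C₂) < weight (C₁ ++ c ∷ C₂)
  weight< = begin-strict
    weight (C₁ ++ D ++ C₂)         ≡⟨ weight-++ C₁ (D ++ C₂) ⟩
    weight C₁ + weight (D ++ C₂)   ≡⟨ cong (weight C₁ +_) (weight-++ D C₂) ⟩
    weight C₁ + (weight D + weight C₂)  <⟨ +-monoʳ-< (weight C₁) (+-monoˡ-< (weight C₂) lighter) ⟩
    weight C₁ + (wc c + weight C₂)  ≡⟨ weight-++ C₁ (c ∷ C₂) ⟨
    weight (C₁ ++ c ∷ C₂)          ∎
    where open ≤-Reasoning

unify-shrinks : ∀ {θ} C₁ C₂ Σ′ M N → N ∈ Σ′ → IsMGU θ M N →
                Shrinks (C₁ ++ ⟦ Σ′ ⊩?[ right ] M ⟧ ∷ C₂) (substCs θ (C₁ ++ C₂))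
unify-shrinks {θ} C₁ C₂ Σ′ M N N∈Σ′ mgu = by-cases identity-or-moves
  where
  open MostGeneralUnifier {θ} {M} {N} mgu
  c : Constraint
  c = ⟦ Σ′ ⊩?[ right ] M ⟧
  A : List Constraint
  A = C₁ ++ c ∷ C₂

  W⊆A : W ⊆ varsCs A
  W⊆A = ⊆-trans (++-lub (xs⊆ys++xs (vars M) (varsL Σ′)) (⊆-trans (concatMap-∈ vars N∈Σ′) (xs⊆xs++ys _ _)))
                (concatMap-∈ varsC (∈-++⁺ʳ C₁ (here refl)))

  rest⊆A : varsCs (C₁ ++ C₂) ⊆ varsCs A
  rest⊆A = concatMap⁺ varsC (++⁺ʳ C₁ (xs⊆x∷xs C₂ c))

  by-cases : (∀ x → θ x ≡ var x) ⊎ (∃ λ x → x ∈ W × θ x ≢ var x) → Shrinks A (substCs θ (C₁ ++ C₂))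
  by-cases (inj₁ identity) =
    subst (Shrinks A) (sym (substCs-identity identity (C₁ ++ C₂))) (replace C₁ C₂ [] (size-pos M))
  by-cases (inj₂ (x , x∈W , moved)) = shrinks vars⊆ (inj₁ (x , W⊆A x∈W , eliminated))
    where
    vars⊆ : varsCs (substCs θ (C₁ ++ C₂)) ⊆ varsCs A
    vars⊆ z∈ with vars-·Cs (C₁ ++ C₂) θ z∈
    ... | y , y∈ , z∈θy with image-vars z∈θy
    ...   | inj₁ z∈W = W⊆A z∈W
    ...   | inj₂ refl = rest⊆A y∈
    eliminated : x ∉ varsCs (substCs θ (C₁ ++ C₂))
    eliminated x∈ = let y , _ , x∈θy = vars-·Cs (C₁ ++ C₂) θ x∈ in moved-eliminated moved y x∈θy

split-shrinks : ∀ C₁ C₂ Σ′ {P M N} → Composite P M N →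
                Shrinks (C₁ ++ ⟦ Σ′ ⊩?[ right ] P ⟧ ∷ C₂)
                        (C₁ ++ ⟦ Σ′ ⊩?[ right ] M ⟧ ∷ ⟦ Σ′ ⊩?[ right ] N ⟧ ∷ C₂)
split-shrinks C₁ C₂ Σ′ {M = M} {N} c =
  replace C₁ C₂ (++⁺ʳ (varsL Σ′) (composite-varsˡ c) ∷ ++⁺ʳ (varsL Σ′) (composite-varsʳ c) ∷ [])
    (≤-<-trans (≤-reflexive (cong (size M +_) (+-identityʳ (size N)))) (composite-size c))

restrict-shrinks : ∀ C₁ C₂ Σ′ M →
                   Shrinks (C₁ ++ ⟦ Σ′ ⊩?[ proper ] M ⟧ ∷ C₂) (C₁ ++ ⟦ Σ′ ⊩?[ right ] M ⟧ ∷ C₂)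
restrict-shrinks C₁ C₂ Σ′ M =
  replace C₁ C₂ (⊆-refl ∷ []) (s≤s (≤-trans (≤-reflexive (+-identityʳ (size M))) (m≤n+m _ _)))

decompose-shrinks : ∀ C₁ C₂ {Γ P M N} U → Composite P M N → P ∈ Γ →
                    Shrinks (C₁ ++ ⟦ Γ ⊩?[ proper ] U ⟧ ∷ C₂)
                            (C₁ ++ ⟦ M ∷ N ∷ remove P Γ ⊩?[ proper ] U ⟧ ∷ C₂)
decompose-shrinks C₁ C₂ {Γ} {P} {M} {N} U c P∈Γ =
  replace C₁ C₂ (++⁺ˡ (vars U) (decompose-vars c P∈Γ) ∷ [])
    (≤-<-trans (≤-reflexive (+-identityʳ _))
      (proper-lighter {Γ = Γ} {M ∷ N ∷ remove P Γ} U (≤-trans (s≤s z≤n) smaller) smaller))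
  where
  smaller : sizeL (M ∷ N ∷ remove P Γ) < sizeL Γ
  smaller = decompose-size c P∈Γ

-- C5: an encryption is opened, at the price of a right constraint for its
-- key; both are paid for by the smaller hypotheses.
open-shrinks : ∀ C₁ C₂ Γ M N U → enc M N ∈ Γ →
               Shrinks (C₁ ++ ⟦ Γ ⊩?[ proper ] U ⟧ ∷ C₂)
                       (C₁ ++ ⟦ Γ ⊩?[ right ] N ⟧ ∷ ⟦ M ∷ N ∷ remove (enc M N) Γ ⊩?[ proper ] U ⟧ ∷ C₂)
open-shrinks C₁ C₂ Γ M N U P∈Γ =
  replace C₁ C₂ (++-lub (xs⊆xs++ys (varsL Γ) (vars U)) (⊆-trans key⊆Γ (xs⊆xs++ys _ _))
                 ∷ ++⁺ˡ (vars U) (decompose-vars encᶜ P∈Γ) ∷ [])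
    (≤-<-trans (≤-reflexive (cong (size N +_) (+-identityʳ _)))
      (proper-lighter {Γ = Γ} {M ∷ N ∷ remove (enc M N) Γ} U key< (decompose-size encᶜ P∈Γ)))
  where
  key⊆Γ : vars N ⊆ varsL Γ
  key⊆Γ = ⊆-trans (composite-varsʳ (encᶜ {M} {N})) (concatMap-∈ vars P∈Γ)
  key< : size N < sizeL Γ
  key< = ≤-trans (s≤s (m≤n+m (size N) (size M))) (size-∈ P∈Γ)

step-shrinks : ∀ {θ A B} → Step θ A B → Shrinks A B
step-shrinks (C1 {θ} C₁ C₂ Σ′ M N _ N∈Σ′ mgu) =
  subst (Shrinks _) (map-++ (substC θ) C₁ C₂) (unify-shrinks C₁ C₂ Σ′ M N N∈Σ′ mgu)
step-shrinks (C2p C₁ C₂ Σ′ M N) = split-shrinks C₁ C₂ Σ′ pairᶜ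
step-shrinks (C2e C₁ C₂ Σ′ M N) = split-shrinks C₁ C₂ Σ′ encᶜ
step-shrinks (C3 C₁ C₂ Σ′ M) = restrict-shrinks C₁ C₂ Σ′ M
step-shrinks (C4 C₁ C₂ Γ M N U P∈Γ) = decompose-shrinks C₁ C₂ U pairᶜ P∈Γ
step-shrinks (C5 C₁ C₂ Γ M N U P∈Γ) = open-shrinks C₁ C₂ Γ M N U P∈Γ

module _ {A : Set} {P Q : A → Set} (P? : Decidable P) (Q? : Decidable Q) (P⇒Q : ∀ {x} → P x → Q x) where

  filter-mono : ∀ xs → length (filter P? xs) ≤ length (filter Q? xs)
  filter-mono [] = z≤n
  filter-mono (y ∷ ys) with P? y | Q? y
  ... | yes _ | yes _ = s≤s (filter-mono ys)
  ... | yes p | no ¬q = contradiction (P⇒Q p) ¬q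
  ... | no _  | yes _ = m≤n⇒m≤1+n (filter-mono ys)
  ... | no _  | no _  = filter-mono ys

  filter-strict : ∀ {x xs} → x ∈ xs → Q x → ¬ P x → length (filter P? xs) < length (filter Q? xs)
  filter-strict {xs = y ∷ ys} (here refl) q ¬p with P? y | Q? y
  ... | yes p | _     = contradiction p ¬p
  ... | no _  | yes _ = s≤s (filter-mono ys)
  ... | no _  | no ¬q = contradiction q ¬q
  filter-strict {xs = y ∷ ys} (there x∈ys) q ¬p with P? y | Q? y
  ... | yes _ | yes _ = s≤s (filter-strict x∈ys q ¬p)
  ... | yes p | no ¬q = contradiction (P⇒Q p) ¬q
  ... | no _  | yes _ = m≤n⇒m≤1+n (filter-strict x∈ys q ¬p)
  ... | no _  | no _  = filter-strict x∈ys q ¬p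

count : List ℕ → List ℕ → ℕ
count V S = length (filter (_∈? S) V)

_<ₗₑₓ_ : ℕ × ℕ → ℕ × ℕ → Set
_<ₗₑₓ_ = ×-Lex _≡_ _<_ _<_

measure : List ℕ → List Constraint → ℕ × ℕ
measure V C = count V (varsCs C) , weight C

shrinks-measure : ∀ {V A B} → varsCs A ⊆ V → Shrinks A B → measure V B <ₗₑₓ measure V A
shrinks-measure {V} {A} {B} A⊆V (shrinks B⊆A (inj₁ (x , x∈A , x∉B))) =
  inj₁ (filter-strict (_∈? varsCs B) (_∈? varsCs A) B⊆A (A⊆V x∈A) x∈A x∉B)
shrinks-measure {V} {A} {B} _ (shrinks B⊆A (inj₂ lighter))
  with m≤n⇒m<n∨m≡n (filter-mono (_∈? varsCs B) (_∈? varsCs A) B⊆A V)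
... | inj₁ fewer = inj₁ fewer
... | inj₂ same = inj₂ (same , lighter)

no-infinite-shrinking : (f : ℕ → List Constraint) → (∀ i → Shrinks (f i) (f (suc i))) → ⊥
no-infinite-shrinking f shrink =
  descent∧wf⇒empty descent (×-wellFounded <-wellFounded <-wellFounded) (measure V (f 0)) (0 , refl)
  where
  V : List ℕ
  V = varsCs (f 0)
  within : ∀ i → varsCs (f i) ⊆ V
  within zero = ⊆-refl
  within (suc i) = within i ∘ Shrinks.vars-⊆ (shrink i)
  Reached : ℕ × ℕ → Set
  Reached μ = ∃ λ i → measure V (f i) ≡ μ
  descent : Descent _<ₗₑₓ_ Reached
  descent (i , refl) = measure V (f (suc i)) , shrinks-measure (within i) (shrink i) , (suc i , refl)

lemma6p11 : (C : List Constraint) → IsDCS C → ¬ InfiniteReduction C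
lemma6p11 C _ (f , _ , steps) = no-infinite-shrinking f (λ i → step-shrinks (proj₂ (steps i)))
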